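{- Let $G$ be a finite simple subcubic graph. Let $B$ be a spanning bipartite subgraph of $G$ with bipartition $V(G)=X\cup Y$ (every edge of $B$ joins a vertex of $X$ to a vertex of $Y$) such that $B$ has the maximum number of edges among all spanning bipartite subgraphs of $G$. Call a vertex bad if it is an end of an edge of $G[X]$ or of an edge of $G[Y]$. Suppose $x_1,x_2\in X$ are two non-adjacent bad vertices having a common neighbor $y\in Y$. Then $x_1$ or $x_2$ has degree $3$ in $G$. Moreover, if one of $x_1$ or $x_2$ has degree $2$ in $G$, then $d_G(y)=3$. The same holds with the roles of $X$ and $Y$ exchanged: if $y_1,y_2\in Y$ are two non-adjacent bad vertices having a common neighbor $x\in X$, then $y_1$ or $y_2$ has degree $3$ in $G$, and if one of $y_1$ or $y_2$ has degree $2$ in $G$, then $d_G(x)=3$.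
   Context: A subcubic graph is a graph in which every vertex has at most three neighbors. A spanning subgraph of $G$ is a subgraph $H$ with $V(H)=V(G)$. $G[S]$ denotes the subgraph of $G$ induced by $S\subseteq V(G)$, and $d_G(v)$ is the degree of $v$ in $G$. -}

module Defs where

open import Data.Nat using (ℕ; zero; suc; _+_; _≤_; _<_)
open import Data.Bool using (Bool; true; false; T; not)
open import Data.Fin using (Fin; toℕ)
open import Data.List using (List; length; filter; allFin)
open import Data.Product using (Σ; ∃; _×_; _,_)
open import Relation.Nullary using (¬_)
open import Relation.Binary.PropositionalEquality using (_≡_; _≢_)
open import Data.Bool.Properties using (T?)
open import Data.Nat.Properties using (_<?_)
open import Data.List using (concatMap; map)
open import Relation.Nullary using (Dec; yes; no)

record Graph (n : ℕ) : Set where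
  field
    adj   : Fin n → Fin n → Bool
    sym   : ∀ u v → adj u v ≡ adj v u
    irrefl : ∀ v → adj v v ≡ false
open Graph public

Adj : ∀ {n} → Graph n → Fin n → Fin n → Set
Adj G u v = T (adj G u v)

deg : ∀ {n} → Graph n → Fin n → ℕ
deg G v = length (filter (λ u → T? (adj G v u)) (allFin _))

Subcubic : ∀ {n} → Graph n → Set
Subcubic G = ∀ v → deg G v ≤ 3

edgeCount : ∀ {n} → Graph n → ℕ
edgeCount {n} G =
  length (filter (λ p → pairOK (Data.Product.proj₁ p) (Data.Product.proj₂ p))
                 (concatMap (λ u → map (λ v → u , v) (allFin n)) (allFin n)))
  where
  pairOK : (u v : Fin n) → Dec (toℕ u < toℕ v × T (adj G u v))
  pairOK u v with toℕ u <? toℕ v | T? (adj G u v)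
  ... | yes p | yes q = yes (p , q)
  ... | no ¬p | _     = no (λ { (p , _) → ¬p p })
  ... | yes _ | no ¬q = no (λ { (_ , q) → ¬q q })

SpanningSubgraph : ∀ {n} → Graph n → Graph n → Set
SpanningSubgraph {n} H G = ∀ (u v : Fin n) → Adj H u v → Adj G u v

-- side : Fin n → Bool is a bipartition (X = side true, Y = side false) of H:
-- every edge of H joins a vertex of X to a vertex of Y
IsBipartition : ∀ {n} → Graph n → (Fin n → Bool) → Set
IsBipartition {n} H side = ∀ (u v : Fin n) → Adj H u v → side u ≢ side v

SpanningBipartite : ∀ {n} → Graph n → Graph n → (Fin n → Bool) → Set
SpanningBipartite G H side = SpanningSubgraph H G × IsBipartition H side

MaxBipartite : ∀ {n} → Graph n → Graph n → (Fin n → Bool) → Set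
MaxBipartite {n} G B side =
  SpanningBipartite G B side ×
  (∀ (B' : Graph n) (side' : Fin n → Bool) →
     SpanningBipartite G B' side' → edgeCount B' ≤ edgeCount B)

Bad : ∀ {n} → Graph n → (Fin n → Bool) → Fin n → Set
Bad {n} G side v = Σ (Fin n) λ u → Adj G v u × side u ≡ side v

-- Flip the side of every vertex of S = {x₁, x₂, y}. Exactly the edges leaving S change status,
-- so maximality of the cut realised by B says that at least as many edges leaving S cross as stay
-- internal. Two internal ones are x₁a₁ and x₂a₂, where a₁, a₂ are the same-side neighbours
-- witnessing badness; a crossing edge leaving S must end at a neighbour of x₁ other than a₁, y,
-- of x₂ other than a₂, y, or of y other than x₁, x₂. Hence
-- (deg x₁ − 2) + (deg x₂ − 2) + (deg y − 2) ≥ 2, which in a subcubic graph gives both claims.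
module Submission where

open import Defs hiding (sym)
open import Algebra.Bundles using (CommutativeRing)
open import Data.Bool using (Bool; true; false; T; not; _∧_; _xor_)
open import Data.Bool.Properties using (T?; T-∧; not-¬; xor-comm; xor-∧-commutativeRing)
open import Algebra.Properties.CommutativeSemigroup
  (CommutativeRing.+-commutativeSemigroup xor-∧-commutativeRing)
  using () renaming (interchange to xor-interchange)
open import Data.Empty using (⊥; ⊥-elim)
open import Data.Fin using (Fin; _<_; _<?_)
open import Data.Fin.Properties using (_≟_; <-cmp; <-asym)
open import Data.Nat using (ℕ; suc; _+_; _≤_; z≤n; s≤s; s≤s⁻¹)
open import Data.Nat.Properties
  using (+-suc; ≤-refl; ≤-reflexive; ≤-trans; <-irrefl; ≤∧≢⇒<;
         +-mono-≤; +-monoˡ-≤; +-cancelˡ-≤; +-cancelʳ-≤; module ≤-Reasoning)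
  renaming (_≟_ to _≟ℕ_)
open import Data.List using (List; []; _∷_; _++_; length; map; filter; concatMap; allFin; cartesianProduct)
open import Data.List.Properties using (filter-notAll; length-map; length-++; map-∘; map-cong-local; map-id)
open import Data.List.Membership.Propositional using (_∈_; _∉_)
open import Data.List.Membership.Propositional.Properties
  using (∈-filter⁺; ∈-filter⁻; ∈-allFin; ∈-cartesianProduct⁺; ∈-map⁺; ∈-map⁻; ∈-++⁺ˡ; ∈-++⁺ʳ)
import Data.List.Membership.DecPropositional as DecMembership
open import Data.List.Relation.Unary.All as All using (All; []; _∷_)
open import Data.List.Relation.Unary.Any as Any using (here; there)
open import Data.List.Relation.Unary.AllPairs using ([]; _∷_)
open import Data.List.Relation.Unary.Unique.Propositional using (Unique)
open import Data.List.Relation.Unary.Unique.Propositional.Properties as Unique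
  using (allFin⁺; cartesianProduct⁺; map⁻)
open import Data.List.Relation.Binary.Subset.Propositional using (_⊆_)
open import Data.List.Relation.Binary.Sublist.Propositional using (⊆-refl)
import Data.List.Relation.Binary.Sublist.Propositional.Properties as Sublist
open import Data.Product using (_×_; _,_; proj₁; proj₂; swap)
open import Data.Product.Properties using (≡-dec)
open import Data.Sum using (_⊎_; inj₁; inj₂; [_,_]′)
open import Function using (_∘_; id; _⇔_; mk⇔; Equivalence)
open import Level using (Level; 0ℓ)
open import Relation.Nullary using (¬_; yes; no; does; ¬?; _×-dec_)
open import Relation.Unary using (Pred; Decidable; _∩_; ∁) renaming (_⊆_ to _⇒_)
open import Relation.Unary.Properties using (_∩?_; ∁?)
open import Relation.Binary.Definitions using (DecidableEquality; tri<; tri≈; tri>)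
open import Relation.Binary.PropositionalEquality using (_≡_; _≢_; refl; sym; trans; cong; cong₂; subst; module ≡-Reasoning)

private variable
  a p q : Level
  A : Set a

T-xor⇔≢ : ∀ {x y} → T (x xor y) ⇔ x ≢ y
T-xor⇔≢ {false} {false} = mk⇔ (λ ()) (λ x≢x → x≢x refl)
T-xor⇔≢ {false} {true}  = mk⇔ (λ _ ()) _
T-xor⇔≢ {true}  {false} = mk⇔ (λ _ ()) _
T-xor⇔≢ {true}  {true}  = mk⇔ (λ ()) (λ x≢x → x≢x refl)

≡⇒¬T-xor : ∀ {x y} → x ≡ y → ¬ T (x xor y)
≡⇒¬T-xor x≡y t = Equivalence.to T-xor⇔≢ t x≡y

T-xor⁺ˡ : ∀ {x y} → ¬ T x → T y → T (x xor y)
T-xor⁺ˡ {false} _   ty = ty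
T-xor⁺ˡ {true}  ¬tx _  = ⊥-elim (¬tx _)

T-xor⁺ʳ : ∀ {x y} → T x → ¬ T y → T (x xor y)
T-xor⁺ʳ {x} {y} tx ¬ty = subst T (xor-comm y x) (T-xor⁺ˡ ¬ty tx)

count : {P : Pred A p} → Decidable P → List A → ℕ
count P? = length ∘ filter P?

module _ {P : Pred A p} {Q : Pred A q} (P? : Decidable P) (Q? : Decidable Q) where

  count-mono : P ⇒ Q → ∀ xs → count P? xs ≤ count Q? xs
  count-mono P⇒Q xs = Sublist.length-mono-≤ (Sublist.filter⁺ P? Q? (λ { refl → P⇒Q }) (⊆-refl {x = xs}))

  count-split : ∀ xs → count P? xs ≡ count (P? ∩? Q?) xs + count (P? ∩? ∁? Q?) xs
  count-split []       = refl
  count-split (x ∷ xs) with P? x | Q? x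
  ... | yes _ | yes _ = cong suc (count-split xs)
  ... | yes _ | no _  = trans (cong suc (count-split xs)) (sym (+-suc _ _))
  ... | no _  | _     = count-split xs

module _ (_≟ᴬ_ : DecidableEquality A) where

  Unique∧⊆⇒length≤ : {xs ys : List A} → Unique xs → xs ⊆ ys → length xs ≤ length ys
  Unique∧⊆⇒length≤ {xs = []}     _              _       = z≤n
  Unique∧⊆⇒length≤ {xs = x ∷ xs} {ys} (x∉xs ∷ xs!) x∷xs⊆ys =
    ≤-trans (s≤s (Unique∧⊆⇒length≤ xs! xs⊆ys∖x)) (filter-notAll (¬? ∘ (_≟ᴬ x)) ys x∈ys)
    where
    x∈ys = Any.map (λ { refl x≢x → x≢x refl }) (x∷xs⊆ys (here refl))
    xs⊆ys∖x : xs ⊆ filter (¬? ∘ (_≟ᴬ x)) ys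
    xs⊆ys∖x z∈xs = ∈-filter⁺ _ (x∷xs⊆ys (there z∈xs)) (λ { refl → All.lookup x∉xs z∈xs refl })

  module _ {P : Pred A p} (P? : Decidable P) where

    length≤count : {ks xs : List A} → Unique ks → (∀ {k} → k ∈ ks → k ∈ xs × P k) →
                   length ks ≤ count P? xs
    length≤count ks! ks⊆ = Unique∧⊆⇒length≤ ks! λ k∈ks →
      let k∈xs , pk = ks⊆ k∈ks in ∈-filter⁺ P? k∈xs pk

    count≤length : {xs ks : List A} → Unique xs → (∀ {x} → x ∈ xs → P x → x ∈ ks) →
                   count P? xs ≤ length ks
    count≤length xs! ⊆ks = Unique∧⊆⇒length≤ (Unique.filter⁺ P? xs!) λ x∈ →
      let x∈xs , px = ∈-filter⁻ P? x∈ in ⊆ks x∈xs px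

module _ {P : Pred (A × A) p} (P? : Decidable P) where

  orderBy : A × A → A × A
  orderBy e with P? e
  ... | yes _ = e
  ... | no  _ = swap e

  orderBy-elim : ∀ {r} (R : Pred (A × A) r) {e} → (P e → R e) → (¬ P e → R (swap e)) → R (orderBy e)
  orderBy-elim R {e} yes⇒R no⇒R with P? e
  ... | yes pe  = yes⇒R pe
  ... | no  ¬pe = no⇒R ¬pe

  orderBy-either : ∀ e → orderBy e ≡ e ⊎ orderBy e ≡ swap e
  orderBy-either e = orderBy-elim (λ e′ → e′ ≡ e ⊎ e′ ≡ swap e) (λ _ → inj₁ refl) (λ _ → inj₂ refl)

  orderBy-chooses : ∀ {e} → P e → ¬ P (swap e) →
                    ∀ {e′} → e′ ≡ e ⊎ e′ ≡ swap e → orderBy e′ ≡ e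
  orderBy-chooses pe ¬pe′ (inj₁ refl) = orderBy-elim (_≡ _) (λ _ → refl) (λ ¬pe → ⊥-elim (¬pe pe))
  orderBy-chooses pe ¬pe′ (inj₂ refl) = orderBy-elim (_≡ _) (λ pe′ → ⊥-elim (¬pe′ pe′)) (λ _ → refl)

  orderBy-satisfies : ∀ {r} {R : Pred (A × A) r} {e} → P e ⊎ P (swap e) → R e → R (swap e) →
                      (P ∩ R) (orderBy e)
  orderBy-satisfies {R = R} pe⊎pe′ re re′ = orderBy-elim (P ∩ R) (_, re) λ ¬pe →
    [ (λ pe → ⊥-elim (¬pe pe)) , id ]′ pe⊎pe′ , re′

module _ {n : ℕ} (G : Graph n) where

  open DecMembership (_≟_ {n}) using (_∈?_)

  Adj-sym : ∀ {u v} → Adj G u v → Adj G v u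
  Adj-sym {u} {v} = subst T (Graph.sym G u v)

  Adj-irrefl : ∀ {u v} → Adj G u v → u ≢ v
  Adj-irrefl {u} u~u refl = subst T (Graph.irrefl G u) u~u

  otherNeighbours : Fin n → List (Fin n) → List (Fin n)
  otherNeighbours v ks = filter ((T? ∘ adj G v) ∩? ∁? (_∈? ks)) (allFin n)

  neighbour-∈⊎∈otherNeighbours : ∀ {v t} ks → Adj G v t → t ∈ ks ⊎ t ∈ otherNeighbours v ks
  neighbour-∈⊎∈otherNeighbours {t = t} ks v~t with t ∈? ks
  ... | yes t∈ks = inj₁ t∈ks
  ... | no  t∉ks = inj₂ (∈-filter⁺ _ (∈-allFin _) (v~t , t∉ks))

  length-otherNeighbours : ∀ {v ks k} → Unique ks → All (Adj G v) ks → deg G v ≤ length ks + k →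
                           length (otherNeighbours v ks) ≤ k
  length-otherNeighbours {v} {ks} {k} ks! v~ks deg≤ = +-cancelˡ-≤ (length ks) _ _ (begin
    length ks + length (otherNeighbours v ks)
      ≤⟨ +-monoˡ-≤ _ (length≤count _≟_ _ ks! (λ k∈ks → ∈-allFin _ , All.lookup v~ks k∈ks , k∈ks)) ⟩
    count (Adj? ∩? (_∈? ks)) (allFin n) + count (Adj? ∩? ∁? (_∈? ks)) (allFin n)
      ≡⟨ count-split Adj? (_∈? ks) (allFin n) ⟨
    deg G v
      ≤⟨ deg≤ ⟩
    length ks + k ∎)
    where
    open ≤-Reasoning
    Adj? = T? ∘ adj G v

Pair : ℕ → Set
Pair n = Fin n × Fin n

concatMap≡cartesianProduct : {A B : Set} (xs : List A) (ys : List B) →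
                             concatMap (λ u → map (λ v → u , v) ys) xs ≡ cartesianProduct xs ys
concatMap≡cartesianProduct []       ys = refl
concatMap≡cartesianProduct (x ∷ xs) ys = cong (map (x ,_) ys ++_) (concatMap≡cartesianProduct xs ys)

-- Spelled as in edgeCount, so that edgeCount H is definitionally a count over pairs n.
pairs : (n : ℕ) → List (Pair n)
pairs n = concatMap (λ u → map (λ v → u , v) (allFin n)) (allFin n)

∈-pairs : ∀ {n} (e : Pair n) → e ∈ pairs n
∈-pairs {n} (u , v) = subst ((u , v) ∈_) (sym (concatMap≡cartesianProduct (allFin n) (allFin n)))
                        (∈-cartesianProduct⁺ (∈-allFin u) (∈-allFin v))

pairs! : ∀ n → Unique (pairs n)
pairs! n = subst Unique (sym (concatMap≡cartesianProduct (allFin n) (allFin n)))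
             (cartesianProduct⁺ (allFin⁺ n) (allFin⁺ n))

module _ {n : ℕ} where

  Below : Pred (Pair n) 0ℓ
  Below (u , v) = u < v

  Below? : Decidable Below
  Below? (u , v) = u <? v

  ≢⇒below⊎above : ∀ {u v} → u ≢ v → Below (u , v) ⊎ Below (v , u)
  ≢⇒below⊎above {u} {v} u≢v with <-cmp u v
  ... | tri< u<v _ _ = inj₁ u<v
  ... | tri≈ _ u≡v _ = ⊥-elim (u≢v u≡v)
  ... | tri> _ _ v<u = inj₂ v<u

  -- An edge occurs in pairs n in both orientations; only its ord-form u < v is counted.
  ord : Pair n → Pair n
  ord = orderBy Below?

  Split : (Fin n → Bool) → Pred (Pair n) 0ℓ
  Split σ (u , v) = T (σ u xor σ v)

  Split? : (σ : Fin n → Bool) → Decidable (Split σ)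
  Split? σ (u , v) = T? (σ u xor σ v)

module _ {n : ℕ} (G : Graph n) where

  Link : Pred (Pair n) 0ℓ
  Link (u , v) = Adj G u v

  Link? : Decidable Link
  Link? (u , v) = T? (adj G u v)

  InCut : (Fin n → Bool) → Pred (Pair n) 0ℓ
  InCut σ = Below ∩ Link ∩ Split σ

  InCut? : (σ : Fin n → Bool) → Decidable (InCut σ)
  InCut? σ = Below? ∩? Link? ∩? Split? σ

  cut : (Fin n → Bool) → ℕ
  cut σ = count (InCut? σ) (pairs n)

  MaxCut : (Fin n → Bool) → Set
  MaxCut side = ∀ σ → cut σ ≤ cut side

  cutGraph : (Fin n → Bool) → Graph n
  cutGraph σ = record
    { adj    = λ u v → adj G u v ∧ (σ u xor σ v)
    ; sym    = λ u v → cong₂ _∧_ (Graph.sym G u v) (xor-comm (σ u) (σ v))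
    ; irrefl = λ v → cong (_∧ (σ v xor σ v)) (Graph.irrefl G v)
    }

  maxBipartite⇒maxCut : ∀ {B side} → MaxBipartite G B side → MaxCut side
  maxBipartite⇒maxCut {B} {side} ((B⊆G , B-bipartite) , B-maximum) σ = begin
    cut σ
      ≤⟨ count-mono _ _ (λ (u<v , u~v , split) → u<v , Equivalence.from T-∧ (u~v , split)) (pairs n) ⟩
    edgeCount (cutGraph σ)
      ≤⟨ B-maximum (cutGraph σ) σ (cutGraph-spanning , cutGraph-bipartite) ⟩
    edgeCount B
      ≤⟨ count-mono _ _ (λ {(u , v)} (u<v , u~v) → u<v , B⊆G u v u~v ,
                          Equivalence.from T-xor⇔≢ (B-bipartite u v u~v)) (pairs n) ⟩
    cut side ∎
    where
    open ≤-Reasoning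
    cutGraph-spanning : SpanningSubgraph (cutGraph σ) G
    cutGraph-spanning u v = proj₁ ∘ Equivalence.to T-∧
    cutGraph-bipartite : IsBipartition (cutGraph σ) σ
    cutGraph-bipartite u v = Equivalence.to T-xor⇔≢ ∘ proj₂ ∘ Equivalence.to (T-∧ {adj G u v})

  module LocalOptimality {side} (maxCut : MaxCut side) {s} {S : Pred (Fin n) s} (S? : Decidable S) where

    Leaving : Pred (Pair n) 0ℓ
    Leaving = Split (does ∘ S?)

    Leaving? : Decidable Leaving
    Leaving? = Split? (does ∘ S?)

    Internal : Pred (Pair n) 0ℓ
    Internal = Link ∩ ∁ (Split side) ∩ Leaving

    Internal? : Decidable Internal
    Internal? = Link? ∩? ∁? (Split? side) ∩? Leaving?

    Crossing : Pred (Pair n) 0ℓ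
    Crossing = Link ∩ Split side ∩ Leaving

    Crossing? : Decidable Crossing
    Crossing? = Link? ∩? Split? side ∩? Leaving?

    -- Flipping S makes the internal edges leaving S cross and the crossing ones internal, and
    -- changes nothing else; the remaining crossing edges are counted by kept on both sides.
    internal≤crossing : count (Below? ∩? Internal?) (pairs n) ≤ count (Below? ∩? Crossing?) (pairs n)
    internal≤crossing = +-cancelʳ-≤ kept _ _ (begin
      count (Below? ∩? Internal?) (pairs n) + kept
        ≤⟨ +-mono-≤ (count-mono _ _ (λ (u<v , u~v , ¬split , leaving) →
                                       (u<v , u~v , internal⇒split ¬split leaving) , leaving) (pairs n))
                    (count-mono _ _ (λ ((u<v , u~v , split) , ¬leaving) →
                                       (u<v , u~v , kept⇒split split ¬leaving) , ¬leaving) (pairs n)) ⟩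
      count (InCut? flipped ∩? Leaving?) (pairs n) + count (InCut? flipped ∩? ∁? Leaving?) (pairs n)
        ≡⟨ count-split (InCut? flipped) Leaving? (pairs n) ⟨
      cut flipped
        ≤⟨ maxCut flipped ⟩
      cut side
        ≡⟨ count-split (InCut? side) Leaving? (pairs n) ⟩
      count (InCut? side ∩? Leaving?) (pairs n) + kept
        ≤⟨ +-monoˡ-≤ kept (count-mono _ _ (λ ((u<v , u~v , split) , leaving) → u<v , u~v , split , leaving)
                                          (pairs n)) ⟩
      count (Below? ∩? Crossing?) (pairs n) + kept ∎)
      where
      open ≤-Reasoning
      flipped : Fin n → Bool
      flipped v = side v xor does (S? v)
      kept = count (InCut? side ∩? ∁? Leaving?) (pairs n)
      internal⇒split : ∀ {e} → ¬ Split side e → Leaving e → Split flipped e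
      internal⇒split {u , v} ¬split leaving =
        subst T (xor-interchange (side u) (side v) _ _) (T-xor⁺ˡ ¬split leaving)
      kept⇒split : ∀ {e} → Split side e → ¬ Leaving e → Split flipped e
      kept⇒split {u , v} split ¬leaving =
        subst T (xor-interchange (side u) (side v) _ _) (T-xor⁺ʳ split ¬leaving)

    Outgoing : Pred (Pair n) s
    Outgoing (u , v) = S u × ¬ S v

    Outgoing? : Decidable Outgoing
    Outgoing? (u , v) = S? u ×-dec ¬? (S? v)

    Gain : Pred (Pair n) s
    Gain (u , v) = Outgoing (u , v) × Adj G u v × side u ≡ side v

    Loss : Pred (Pair n) s
    Loss (u , v) = Outgoing (u , v) × Adj G u v × side u ≢ side v

    outgoing⇒leaving : ∀ {u v} → Outgoing (u , v) → Leaving (u , v) × Leaving (v , u)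
    outgoing⇒leaving {u} {v} (su , ¬sv) with S? u | S? v
    ... | yes _   | no _   = _ , _
    ... | no ¬su  | _      = ⊥-elim (¬su su)
    ... | yes _   | yes sv = ⊥-elim (¬sv sv)

    leaving⇒outgoing : ∀ {u v} → Leaving (u , v) → Outgoing (u , v) ⊎ Outgoing (v , u)
    leaving⇒outgoing {u} {v} leaving with S? u | S? v
    ... | yes su  | no ¬sv = inj₁ (su , ¬sv)
    ... | no ¬su  | yes sv = inj₂ (sv , ¬su)

    orient : Pair n → Pair n
    orient = orderBy Outgoing?

    ord-gain : ∀ {e} → Gain e → (Below ∩ Internal) (ord e)
    ord-gain {u , v} (out@(su , ¬sv) , u~v , same) =
      orderBy-satisfies Below? {R = Internal} (≢⇒below⊎above λ { refl → ¬sv su })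
        (u~v , ≡⇒¬T-xor same , proj₁ (outgoing⇒leaving out))
        (Adj-sym G u~v , ≡⇒¬T-xor (sym same) , proj₂ (outgoing⇒leaving out))

    orient∘ord : ∀ {e} → Gain e → orient (ord e) ≡ e
    orient∘ord {e} (out , _) = orderBy-chooses Outgoing? out (λ (sv , _) → proj₂ out sv) (orderBy-either Below? e)

    orient-crossing : ∀ {e} → (Below ∩ Crossing) e → Loss (orient e) × ord (orient e) ≡ e
    orient-crossing {u , v} (u<v , u~v , split , leaving) =
      (out , link , Equivalence.to T-xor⇔≢ split′) ,
      orderBy-chooses Below? u<v (<-asym u<v) (orderBy-either Outgoing? (u , v))
      where
      oriented = orderBy-satisfies Outgoing? {R = Link ∩ Split side} (leaving⇒outgoing leaving)
                   (u~v , split) (Adj-sym G u~v , subst T (xor-comm (side u) (side v)) split)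
      out = proj₁ oriented
      link = proj₁ (proj₂ oriented)
      split′ = proj₂ (proj₂ oriented)

    -- ord and orient are mutually inverse between oriented edges leaving S and their
    -- representatives u < v in pairs n.
    gains≤losses : ∀ {gs ls} → Unique gs → All Gain gs → (∀ {e} → Loss e → e ∈ ls) →
                   length gs ≤ length ls
    gains≤losses {gs} {ls} gs! gains loss⇒∈ls = begin
      length gs                              ≡⟨ length-map ord gs ⟨
      length (map ord gs)                    ≤⟨ length≤count _≟ₚ_ _ ord-gs! ord-gs-internal ⟩
      count (Below? ∩? Internal?) (pairs n)  ≤⟨ internal≤crossing ⟩
      count (Below? ∩? Crossing?) (pairs n)  ≤⟨ count≤length _≟ₚ_ _ (pairs! n) crossing⇒∈ ⟩
      length (map ord ls)                    ≡⟨ length-map ord ls ⟩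
      length ls                              ∎
      where
      open ≤-Reasoning
      _≟ₚ_ : DecidableEquality (Pair n)
      _≟ₚ_ = ≡-dec _≟_ _≟_
      gs≡orient∘ord : gs ≡ map orient (map ord gs)
      gs≡orient∘ord = trans (sym (map-id gs)) (trans (sym (map-cong-local (All.map orient∘ord gains))) (map-∘ gs))
      ord-gs! : Unique (map ord gs)
      ord-gs! = map⁻ {f = orient} (subst Unique gs≡orient∘ord gs!)
      ord-gs-internal : ∀ {e′} → e′ ∈ map ord gs → e′ ∈ pairs n × (Below ∩ Internal) e′
      ord-gs-internal e′∈ with ∈-map⁻ ord e′∈
      ... | _ , e∈gs , refl = ∈-pairs _ , ord-gain (All.lookup gains e∈gs)
      crossing⇒∈ : ∀ {e} → e ∈ pairs n → (Below ∩ Crossing) e → e ∈ map ord ls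
      crossing⇒∈ _ crossing = let loss , ord∘orient = orient-crossing crossing in
        subst (_∈ map ord ls) ord∘orient (∈-map⁺ ord (loss⇒∈ls loss))

module BadCherry {n} {G : Graph n} {side : Fin n → Bool} (maxCut : MaxCut G side) (subcubic : Subcubic G)
  {s : Bool} {x₁ x₂ y a₁ a₂ : Fin n}
  (x₁∈X : side x₁ ≡ s) (x₂∈X : side x₂ ≡ s) (y∈Y : side y ≡ not s)
  (x₁≢x₂ : x₁ ≢ x₂) (x₁≁x₂ : ¬ Adj G x₁ x₂)
  (x₁~a₁ : Adj G x₁ a₁) (a₁≈x₁ : side a₁ ≡ side x₁)
  (x₂~a₂ : Adj G x₂ a₂) (a₂≈x₂ : side a₂ ≡ side x₂)
  (x₁~y : Adj G x₁ y) (x₂~y : Adj G x₂ y) where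

  open DecMembership (_≟_ {n}) using (_∈?_)

  X∌y : ∀ {u} → side u ≡ s → u ≢ y
  X∌y u∈X refl = not-¬ refl (trans (sym u∈X) y∈Y)

  a₁≢y : a₁ ≢ y
  a₁≢y = X∌y (trans a₁≈x₁ x₁∈X)

  a₂≢y : a₂ ≢ y
  a₂≢y = X∌y (trans a₂≈x₂ x₂∈X)

  others₁ others₂ othersʸ : List (Fin n)
  others₁ = otherNeighbours G x₁ (a₁ ∷ y ∷ [])
  others₂ = otherNeighbours G x₂ (a₂ ∷ y ∷ [])
  othersʸ = otherNeighbours G y (x₁ ∷ x₂ ∷ [])

  S₃ : List (Fin n)
  S₃ = x₁ ∷ x₂ ∷ y ∷ []

  module S₃ = LocalOptimality G {side} maxCut (_∈? S₃)

  ∉S₃ : ∀ {t} → t ≢ x₁ → t ≢ x₂ → t ≢ y → t ∉ S₃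
  ∉S₃ t≢x₁ _    _   (here t≡x₁)                = t≢x₁ t≡x₁
  ∉S₃ _    t≢x₂ _   (there (here t≡x₂))        = t≢x₂ t≡x₂
  ∉S₃ _    _    t≢y (there (there (here t≡y))) = t≢y t≡y

  gains : All S₃.Gain ((x₁ , a₁) ∷ (x₂ , a₂) ∷ [])
  gains = ((here refl , a₁∉S₃) , x₁~a₁ , sym a₁≈x₁)
        ∷ ((there (here refl) , a₂∉S₃) , x₂~a₂ , sym a₂≈x₂)
        ∷ []
    where
    a₁∉S₃ = ∉S₃ (λ { refl → Adj-irrefl G x₁~a₁ refl }) (λ { refl → x₁≁x₂ x₁~a₁ }) a₁≢y
    a₂∉S₃ = ∉S₃ (λ { refl → x₁≁x₂ (Adj-sym G x₂~a₂) }) (λ { refl → Adj-irrefl G x₂~a₂ refl }) a₂≢y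

  losses : List (Pair n)
  losses = map (x₁ ,_) others₁ ++ map (x₂ ,_) others₂ ++ map (y ,_) othersʸ

  length-losses : length losses ≡ length others₁ + (length others₂ + length othersʸ)
  length-losses = begin
    length losses
      ≡⟨ length-++ (map (x₁ ,_) others₁) ⟩
    length (map (x₁ ,_) others₁) + length (map (x₂ ,_) others₂ ++ map (y ,_) othersʸ)
      ≡⟨ cong₂ _+_ (length-map (x₁ ,_) others₁) (length-++ (map (x₂ ,_) others₂)) ⟩
    length others₁ + (length (map (x₂ ,_) others₂) + length (map (y ,_) othersʸ))
      ≡⟨ cong₂ (λ m k → length others₁ + (m + k))
               (length-map (x₂ ,_) others₂) (length-map (y ,_) othersʸ) ⟩
    length others₁ + (length others₂ + length othersʸ) ∎
    where open ≡-Reasoning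

  loss⇒∈losses : ∀ {e} → S₃.Loss e → e ∈ losses
  loss⇒∈losses ((here refl , t∉S₃) , x₁~t , x₁≉t)
    with neighbour-∈⊎∈otherNeighbours G (a₁ ∷ y ∷ []) x₁~t
  ... | inj₁ (here refl)         = ⊥-elim (x₁≉t (sym a₁≈x₁))
  ... | inj₁ (there (here refl)) = ⊥-elim (t∉S₃ (there (there (here refl))))
  ... | inj₂ t∈others = ∈-++⁺ˡ (∈-map⁺ (x₁ ,_) t∈others)
  loss⇒∈losses ((there (here refl) , t∉S₃) , x₂~t , x₂≉t)
    with neighbour-∈⊎∈otherNeighbours G (a₂ ∷ y ∷ []) x₂~t
  ... | inj₁ (here refl)         = ⊥-elim (x₂≉t (sym a₂≈x₂))
  ... | inj₁ (there (here refl)) = ⊥-elim (t∉S₃ (there (there (here refl))))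
  ... | inj₂ t∈others = ∈-++⁺ʳ (map (x₁ ,_) others₁) (∈-++⁺ˡ (∈-map⁺ (x₂ ,_) t∈others))
  loss⇒∈losses ((there (there (here refl)) , t∉S₃) , y~t , _)
    with neighbour-∈⊎∈otherNeighbours G (x₁ ∷ x₂ ∷ []) y~t
  ... | inj₁ (here refl)         = ⊥-elim (t∉S₃ (here refl))
  ... | inj₁ (there (here refl)) = ⊥-elim (t∉S₃ (there (here refl)))
  ... | inj₂ t∈others =
    ∈-++⁺ʳ (map (x₁ ,_) others₁) (∈-++⁺ʳ (map (x₂ ,_) others₂) (∈-map⁺ (y ,_) t∈others))

  two≤others : 2 ≤ length others₁ + (length others₂ + length othersʸ)
  two≤others = ≤-trans (S₃.gains≤losses gains! gains loss⇒∈losses) (≤-reflexive length-losses)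
    where
    gains! : Unique ((x₁ , a₁) ∷ (x₂ , a₂) ∷ [])
    gains! = ((x₁≢x₂ ∘ cong proj₁) ∷ []) ∷ [] ∷ []

  low-degrees-impossible : ∀ {k₁ k₂ kʸ} → deg G x₁ ≤ 2 + k₁ → deg G x₂ ≤ 2 + k₂ → deg G y ≤ 2 + kʸ →
                           k₁ + (k₂ + kʸ) ≤ 1 → ⊥
  low-degrees-impossible deg₁ deg₂ degʸ k≤1 = <-irrefl refl (≤-trans two≤others (≤-trans others≤k k≤1))
    where
    others≤k = +-mono-≤ (length-otherNeighbours G ((a₁≢y ∷ []) ∷ [] ∷ []) (x₁~a₁ ∷ x₁~y ∷ []) deg₁)
               (+-mono-≤ (length-otherNeighbours G ((a₂≢y ∷ []) ∷ [] ∷ []) (x₂~a₂ ∷ x₂~y ∷ []) deg₂)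
                         (length-otherNeighbours G ((x₁≢x₂ ∷ []) ∷ [] ∷ [])
                                                   (Adj-sym G x₁~y ∷ Adj-sym G x₂~y ∷ []) degʸ))

  ≢3⇒≤2 : ∀ {v} → deg G v ≢ 3 → deg G v ≤ 2
  ≢3⇒≤2 {v} deg≢3 = s≤s⁻¹ (≤∧≢⇒< (subcubic v) deg≢3)

  some-degree-3 : deg G x₁ ≡ 3 ⊎ deg G x₂ ≡ 3
  some-degree-3 with deg G x₁ ≟ℕ 3 | deg G x₂ ≟ℕ 3
  ... | yes deg₁≡3 | _          = inj₁ deg₁≡3
  ... | no _       | yes deg₂≡3 = inj₂ deg₂≡3
  ... | no deg₁≢3  | no deg₂≢3  =
    ⊥-elim (low-degrees-impossible (≢3⇒≤2 deg₁≢3) (≢3⇒≤2 deg₂≢3) (subcubic y) ≤-refl)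

  degree-2⇒y-degree-3 : deg G x₁ ≡ 2 → deg G y ≡ 3
  degree-2⇒y-degree-3 deg₁≡2 with deg G y ≟ℕ 3
  ... | yes degʸ≡3 = degʸ≡3
  ... | no degʸ≢3  =
    ⊥-elim (low-degrees-impossible (≤-reflexive deg₁≡2) (subcubic x₂) (≢3⇒≤2 degʸ≢3) ≤-refl)

lemma2 : ∀ {n : ℕ} (G B : Graph n) (side : Fin n → Bool) →
    Subcubic G → MaxBipartite G B side →
    ∀ (s : Bool) (x₁ x₂ y : Fin n) →
    side x₁ ≡ s → side x₂ ≡ s → side y ≡ not s →
    x₁ ≢ x₂ → ¬ Adj G x₁ x₂ →
    Bad G side x₁ → Bad G side x₂ →
    Adj G x₁ y → Adj G x₂ y →
    (deg G x₁ ≡ 3 ⊎ deg G x₂ ≡ 3) ×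
    ((deg G x₁ ≡ 2 ⊎ deg G x₂ ≡ 2) → deg G y ≡ 3)
lemma2 G B side subcubic maxBipartite s x₁ x₂ y x₁∈X x₂∈X y∈Y x₁≢x₂ x₁≁x₂
       (a₁ , x₁~a₁ , a₁≈x₁) (a₂ , x₂~a₂ , a₂≈x₂) x₁~y x₂~y =
  C₁₂.some-degree-3 , [ C₁₂.degree-2⇒y-degree-3 , C₂₁.degree-2⇒y-degree-3 ]′
  where
  maxCut : MaxCut G side
  maxCut = maxBipartite⇒maxCut G maxBipartite
  module C₁₂ = BadCherry {G = G} {side} maxCut subcubic x₁∈X x₂∈X y∈Y x₁≢x₂ x₁≁x₂
                 x₁~a₁ a₁≈x₁ x₂~a₂ a₂≈x₂ x₁~y x₂~y
  module C₂₁ = BadCherry {G = G} {side} maxCut subcubic x₂∈X x₁∈X y∈Y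
                 (x₁≢x₂ ∘ sym) (x₁≁x₂ ∘ Adj-sym G)
                 x₂~a₂ a₂≈x₂ x₁~a₁ a₁≈x₁ x₂~y x₁~y
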